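{- Let $G$ be a connected graph containing no induced $P_2\cup P_4$ and no induced bull, and let $C=v_1v_2\cdots v_7v_1$ be an induced 7-cycle in $G$. If no vertex of $G$ is adjacent to all vertices of $V(C)$, then $V(C)$ is a dominating set of $G$, i.e. every vertex of $V(G)\setminus V(C)$ has a neighbour in $V(C)$.
   Context: All graphs are finite and simple. $P_2\cup P_4$ is the disjoint union of the paths on 2 and 4 vertices. A bull is a triangle with two disjoint pendant edges. -}

module Defs where

open import Data.Nat using (ℕ; suc)
open import Data.Fin using (Fin; zero; suc; toℕ)
open import Data.Fin.Patterns
open import Data.Product using (Σ; ∃; _×_; _,_)
open import Data.Sum using (_⊎_)
open import Data.Empty using (⊥)
open import Data.Unit using (⊤)
open import Relation.Nullary using (¬_; Dec)
open import Relation.Binary.PropositionalEquality using (_≡_; _≢_)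
open import Function using (_⇔_)
open import Function.Definitions using (Injective)
open import Data.List using (List; []; _∷_)

record Graph (n : ℕ) : Set₁ where
  field
    Adj     : Fin n → Fin n → Set
    adj?    : ∀ u v → Dec (Adj u v)
    sym     : ∀ {u v} → Adj u v → Adj v u
    irrefl  : ∀ {u} → ¬ Adj u u
open Graph public

data Walk {n : ℕ} (G : Graph n) : Fin n → Fin n → Set where
  here : ∀ {u} → Walk G u u
  step : ∀ {u w v} → Adj G u w → Walk G w v → Walk G u v

Connected : ∀ {n} → Graph n → Set
Connected G = ∀ u v → Walk G u v

P2∪P4-adj : Fin 6 → Fin 6 → Set
P2∪P4-adj 0F 1F = ⊤
P2∪P4-adj 1F 0F = ⊤
P2∪P4-adj 2F 3F = ⊤
P2∪P4-adj 3F 2F = ⊤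
P2∪P4-adj 3F 4F = ⊤
P2∪P4-adj 4F 3F = ⊤
P2∪P4-adj 4F 5F = ⊤
P2∪P4-adj 5F 4F = ⊤
P2∪P4-adj _ _ = ⊥

Bull-adj : Fin 5 → Fin 5 → Set
Bull-adj 0F 1F = ⊤
Bull-adj 1F 0F = ⊤
Bull-adj 0F 2F = ⊤
Bull-adj 2F 0F = ⊤
Bull-adj 1F 2F = ⊤
Bull-adj 2F 1F = ⊤
Bull-adj 0F 3F = ⊤
Bull-adj 3F 0F = ⊤
Bull-adj 1F 4F = ⊤
Bull-adj 4F 1F = ⊤
Bull-adj _ _ = ⊥

record InducedPattern {k n : ℕ} (H : Fin k → Fin k → Set) (G : Graph n) : Set where
  field
    emb     : Fin k → Fin n
    inj     : Injective _≡_ _≡_ emb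
    adj⇔    : ∀ i j → Adj G (emb i) (emb j) ⇔ H i j

P2∪P4-free : ∀ {n} → Graph n → Set
P2∪P4-free G = ¬ InducedPattern P2∪P4-adj G

Bull-free : ∀ {n} → Graph n → Set
Bull-free G = ¬ InducedPattern Bull-adj G

C7-adj : Fin 7 → Fin 7 → Set
C7-adj i j = toℕ j ≡ (suc (toℕ i)) Data.Nat.% 7 ⊎ toℕ i ≡ (suc (toℕ j)) Data.Nat.% 7
  where import Data.Nat

InducedC7 : ∀ {n} → Graph n → Set
InducedC7 G = InducedPattern C7-adj G

-- If some vertex had no neighbour on C, a walk from it to C would cross an edge wu with w
-- off C and u adjacent to C. The neighbourhood N ⊆ ℤ/7 of u on C is nonempty, and proper
-- because no vertex dominates C. Then w, u and C already induce a forbidden graph: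
-- if i, i+1 ∈ N and i+2 ∉ N, the triangle u vᵢ₊₁ vᵢ with pendants w and vᵢ₊₂ is a bull;
-- otherwise some i ∈ N and d ∈ {0,1} have i+1, i+3+d, i+4+d ∉ N, and the path w u vᵢ vᵢ₊₁
-- together with the edge vᵢ₊₃₊d vᵢ₊₄₊d is an induced P₂ ∪ P₄. The graph on {w, u} ∪ C
-- depends only on N, so this dichotomy is checked by deciding it for all 2⁷ subsets N.
{-# OPTIONS --safe #-}
module Submission where

open import Defs
open import Data.Nat using (ℕ; _+_; _%_) renaming (_≟_ to _≟ℕ_)
open import Data.Nat.DivMod using (_mod_)
open import Data.Fin using (Fin; zero; suc; toℕ; _≟_)
open import Data.Fin.Patterns
open import Data.Fin.Properties using (any?; all?)
open import Data.Fin.Subset using (Subset; _∈_; ∁; Nonempty)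
open import Data.Fin.Subset.Properties using (_∈?_; nonempty?; anySubset?; drop-there; x∉∁p⇒x∈p)
open import Data.Vec using (tabulate; here; there)
open import Data.Product using (Σ; ∃; ∃₂; _×_; _,_)
open import Data.Sum using (_⊎_; inj₁; [_,_]′)
open import Data.Empty using (⊥; ⊥-elim)
open import Data.Unit using (⊤)
open import Relation.Nullary using (¬_; Dec; does; yes; no; ¬?)
open import Relation.Nullary.Decidable
  using (_×-dec_; _⊎-dec_; _→-dec_; map′; from-yes; decidable-stable)
open import Relation.Binary.PropositionalEquality using (_≡_; refl; subst)
open import Function using (_⇔_; mk⇔; Equivalence)
open import Function.Construct.Composition using (_⇔-∘_)
open import Function.Construct.Symmetry using (⇔-sym)

open Equivalence

_⇔-dec_ : {A B : Set} → Dec A → Dec B → Dec (A ⇔ B)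
a? ⇔-dec b? = map′ (λ (f , g) → mk⇔ f g) (λ e → to e , from e) ((a? →-dec b?) ×-dec (b? →-dec a?))

C7-adj? : ∀ i j → Dec (C7-adj i j)
C7-adj? i j = (toℕ j ≟ℕ (1 + toℕ i) % 7) ⊎-dec (toℕ i ≟ℕ (1 + toℕ j) % 7)

Bull-adj? : ∀ i j → Dec (Bull-adj i j)
Bull-adj? = λ
  { 0F 0F → no λ () ; 0F 1F → yes _  ; 0F 2F → yes _  ; 0F 3F → yes _  ; 0F 4F → no λ ()
  ; 1F 0F → yes _  ; 1F 1F → no λ () ; 1F 2F → yes _  ; 1F 3F → no λ () ; 1F 4F → yes _
  ; 2F 0F → yes _  ; 2F 1F → yes _  ; 2F 2F → no λ () ; 2F 3F → no λ () ; 2F 4F → no λ ()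
  ; 3F 0F → yes _  ; 3F 1F → no λ () ; 3F 2F → no λ () ; 3F 3F → no λ () ; 3F 4F → no λ ()
  ; 4F 0F → no λ () ; 4F 1F → yes _  ; 4F 2F → no λ () ; 4F 3F → no λ () ; 4F 4F → no λ ()
  }

P2∪P4-adj? : ∀ i j → Dec (P2∪P4-adj i j)
P2∪P4-adj? = λ
  { 0F 0F → no λ () ; 0F 1F → yes _  ; 0F 2F → no λ () ; 0F 3F → no λ () ; 0F 4F → no λ () ; 0F 5F → no λ ()
  ; 1F 0F → yes _  ; 1F 1F → no λ () ; 1F 2F → no λ () ; 1F 3F → no λ () ; 1F 4F → no λ () ; 1F 5F → no λ ()
  ; 2F 0F → no λ () ; 2F 1F → no λ () ; 2F 2F → no λ () ; 2F 3F → yes _  ; 2F 4F → no λ () ; 2F 5F → no λ ()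
  ; 3F 0F → no λ () ; 3F 1F → no λ () ; 3F 2F → yes _  ; 3F 3F → no λ () ; 3F 4F → yes _  ; 3F 5F → no λ ()
  ; 4F 0F → no λ () ; 4F 1F → no λ () ; 4F 2F → no λ () ; 4F 3F → yes _  ; 4F 4F → no λ () ; 4F 5F → yes _
  ; 5F 0F → no λ () ; 5F 1F → no λ () ; 5F 2F → no λ () ; 5F 3F → no λ () ; 5F 4F → yes _  ; 5F 5F → no λ ()
  }

TwinFree : ∀ {k} → (Fin k → Fin k → Set) → Set
TwinFree H = ∀ i j → (∀ l → H i l ⇔ H j l) → i ≡ j

twinFree? : ∀ {k} {H : Fin k → Fin k → Set} → (∀ i j → Dec (H i j)) → Dec (TwinFree H)
twinFree? H? = all? λ i → all? λ j → all? (λ l → H? i l ⇔-dec H? j l) →-dec (i ≟ j)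

Bull-twinFree : TwinFree Bull-adj
Bull-twinFree = from-yes (twinFree? Bull-adj?)

P2∪P4-twinFree : TwinFree P2∪P4-adj
P2∪P4-twinFree = from-yes (twinFree? P2∪P4-adj?)

twinFree-induced : ∀ {n k} {G : Graph n} {H : Fin k → Fin k → Set} → TwinFree H
                 → (e : Fin k → Fin n) → (∀ i j → Adj G (e i) (e j) ⇔ H i j) → InducedPattern H G
twinFree-induced {G = G} {H} twinFree e adj⇔H = record
  { emb  = e
  ; inj  = λ {i} {j} eᵢ≡eⱼ → twinFree i j λ l →
             adj⇔H j l ⇔-∘ subst (λ z → H i l ⇔ Adj G z (e l)) eᵢ≡eⱼ (⇔-sym (adj⇔H i l))
  ; adj⇔ = adj⇔H
  }

crossing-edge : ∀ {n} (G : Graph n) {P : Fin n → Set} → (∀ x → Dec (P x))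
              → ∀ {x y} → Walk G x y → ¬ P x → P y → ∃₂ λ a b → Adj G a b × ¬ P a × P b
crossing-edge G P? here ¬Px Py = ⊥-elim (¬Px Py)
crossing-edge G P? (step {w = z} xz walk) ¬Px Py with P? z
... | yes Pz  = _ , z , xz , ¬Px , Pz
... | no ¬Pz = crossing-edge G P? walk ¬Pz Py

∈-tabulate-does : ∀ {n} {P : Fin n → Set} (P? : ∀ i → Dec (P i)) i
                → i ∈ tabulate (λ j → does (P? j)) ⇔ P i
∈-tabulate-does P? zero with P? zero
... | yes p  = mk⇔ (λ _ → p) (λ _ → here)
... | no ¬p = mk⇔ (λ ()) (λ p → ⊥-elim (¬p p))
∈-tabulate-does P? (suc i) = ∈-tabulate-does (λ j → P? (suc j)) i ⇔-∘ mk⇔ drop-there there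

data Local : Set where
  far near : Local
  cyc      : Fin 7 → Local

LocalAdj : Subset 7 → Local → Local → Set
LocalAdj N far     near    = ⊤
LocalAdj N near    far     = ⊤
LocalAdj N near    (cyc i) = i ∈ N
LocalAdj N (cyc i) near    = i ∈ N
LocalAdj N (cyc i) (cyc j) = C7-adj i j
LocalAdj N far     far     = ⊥
LocalAdj N far     (cyc j) = ⊥
LocalAdj N near    near    = ⊥
LocalAdj N (cyc i) far     = ⊥

localAdj? : ∀ N x y → Dec (LocalAdj N x y)
localAdj? N far     near    = yes _
localAdj? N near    far     = yes _
localAdj? N near    (cyc i) = i ∈? N
localAdj? N (cyc i) near    = i ∈? N
localAdj? N (cyc i) (cyc j) = C7-adj? i j
localAdj? N far     far     = no λ ()
localAdj? N far     (cyc j) = no λ ()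
localAdj? N near    near    = no λ ()
localAdj? N (cyc i) far     = no λ ()

_⊕_ : Fin 7 → ℕ → Fin 7
i ⊕ k = (toℕ i + k) mod 7

bull-at : Fin 7 → Fin 5 → Local
bull-at i 0F = near
bull-at i 1F = cyc (i ⊕ 1)
bull-at i 2F = cyc i
bull-at i 3F = far
bull-at i 4F = cyc (i ⊕ 2)

P2∪P4-at : Fin 7 → Fin 2 → Fin 6 → Local
P2∪P4-at i d 0F = cyc (i ⊕ (3 + toℕ d))
P2∪P4-at i d 1F = cyc (i ⊕ (4 + toℕ d))
P2∪P4-at i d 2F = far
P2∪P4-at i d 3F = near
P2∪P4-at i d 4F = cyc i
P2∪P4-at i d 5F = cyc (i ⊕ 1)

Realises : ∀ {k} → (Fin k → Fin k → Set) → Subset 7 → (Fin k → Local) → Set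
Realises H N f = ∀ i j → LocalAdj N (f i) (f j) ⇔ H i j

realises? : ∀ {k} {H : Fin k → Fin k → Set} → (∀ i j → Dec (H i j)) → ∀ N f → Dec (Realises H N f)
realises? H? N f = all? λ i → all? λ j → localAdj? N (f i) (f j) ⇔-dec H? i j

Obstruction : Subset 7 → Set
Obstruction N = (∃ λ i → Realises Bull-adj N (bull-at i))
              ⊎ (∃₂ λ i d → Realises P2∪P4-adj N (P2∪P4-at i d))

obstruction? : ∀ N → Dec (Obstruction N)
obstruction? N = any? (λ i → realises? Bull-adj? N (bull-at i))
          ⊎-dec any? (λ i → any? λ d → realises? P2∪P4-adj? N (P2∪P4-at i d))

no-unobstructed-proper-subset : ¬ ∃ λ N → Nonempty N × Nonempty (∁ N) × ¬ Obstruction N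
no-unobstructed-proper-subset =
  from-yes (¬? (anySubset? λ N → nonempty? N ×-dec nonempty? (∁ N) ×-dec ¬? (obstruction? N)))

obstruction : ∀ N → Nonempty N → Nonempty (∁ N) → Obstruction N
obstruction N N≠∅ ∁N≠∅ = decidable-stable (obstruction? N) λ unobstructed →
  no-unobstructed-proper-subset (N , N≠∅ , ∁N≠∅ , unobstructed)

module _ {n} {G : Graph n} (C : InducedC7 G) where
  open InducedPattern C

  AdjacentToC : Fin n → Set
  AdjacentToC x = Σ (Fin 7) λ i → Adj G x (emb i)

  adjacentToC? : ∀ x → Dec (AdjacentToC x)
  adjacentToC? x = any? λ i → adj? G x (emb i)

  Dominating : Fin n → Set
  Dominating x = ∀ i → Adj G x (emb i)

  neighbourhood : Fin n → Subset 7
  neighbourhood x = tabulate λ i → does (adj? G x (emb i))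

  ∈-neighbourhood : ∀ {x} i → i ∈ neighbourhood x ⇔ Adj G x (emb i)
  ∈-neighbourhood {x} = ∈-tabulate-does λ i → adj? G x (emb i)

  ¬dominating⇒∁-neighbourhood-nonempty : ∀ {x} → ¬ Dominating x → Nonempty (∁ (neighbourhood x))
  ¬dominating⇒∁-neighbourhood-nonempty {x} ¬dom = decidable-stable (nonempty? _) λ ∁N=∅ →
    ¬dom λ i → to (∈-neighbourhood i) (x∉∁p⇒x∈p λ i∈∁N → ∁N=∅ (i , i∈∁N))

  module _ {w u} (wu : Adj G w u) (w-off : ¬ AdjacentToC w) where
    place : Local → Fin n
    place far     = w
    place near    = u
    place (cyc i) = emb i

    place-adj : ∀ x y → Adj G (place x) (place y) ⇔ LocalAdj (neighbourhood u) x y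
    place-adj far     far     = mk⇔ (irrefl G) λ ()
    place-adj far     near    = mk⇔ _ λ _ → wu
    place-adj far     (cyc i) = mk⇔ (λ a → w-off (i , a)) λ ()
    place-adj near    far     = mk⇔ _ λ _ → sym G wu
    place-adj near    near    = mk⇔ (irrefl G) λ ()
    place-adj near    (cyc i) = ⇔-sym (∈-neighbourhood i)
    place-adj (cyc i) far     = mk⇔ (λ a → w-off (i , sym G a)) λ ()
    place-adj (cyc i) near    = ⇔-sym (∈-neighbourhood i) ⇔-∘ mk⇔ (sym G) (sym G)
    place-adj (cyc i) (cyc j) = adj⇔ i j

    realise : ∀ {k} {H : Fin k → Fin k → Set} {f : Fin k → Local}
            → TwinFree H → Realises H (neighbourhood u) f → InducedPattern H G
    realise {f = f} twinFree realises =
      twinFree-induced twinFree (λ i → place (f i)) λ i j → realises i j ⇔-∘ place-adj (f i) (f j)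

    neighbour-off-C : P2∪P4-free G → Bull-free G → ¬ Dominating u → ¬ AdjacentToC u
    neighbour-off-C no-P2∪P4 no-bull ¬dom (i , ui) =
      [ (λ (_ , bull) → no-bull (realise Bull-twinFree bull))
      , (λ (_ , _ , p2∪p4) → no-P2∪P4 (realise P2∪P4-twinFree p2∪p4))
      ]′ (obstruction (neighbourhood u) (i , from (∈-neighbourhood i) ui)
                                          (¬dominating⇒∁-neighbourhood-nonempty ¬dom))

lemma3p2 : ∀ {n} (G : Graph n) → Connected G → P2∪P4-free G → Bull-free G
    → (C : InducedC7 G)
    → ¬ (Σ (Fin n) λ x → ∀ i → Adj G x (InducedPattern.emb C i))
    → ∀ v → (∀ i → ¬ (v ≡ InducedPattern.emb C i))
    → Σ (Fin 7) λ i → Adj G v (InducedPattern.emb C i)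
lemma3p2 G connected no-P2∪P4 no-bull C undominated v _ =
  decidable-stable (adjacentToC? C v) λ v-off →
    let w , u , wu , w-off , u-on = crossing-edge G (adjacentToC? C) (connected v (emb 0F)) v-off emb₀-on
    in  neighbour-off-C C wu w-off no-P2∪P4 no-bull (λ dom → undominated (u , dom)) u-on
  where
  open InducedPattern C
  emb₀-on : AdjacentToC C (emb 0F)
  emb₀-on = 1F , from (adj⇔ 0F 1F) (inj₁ refl)
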